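{- Let $n,k,t,r$ be positive integers with $1\leq r\leq k$. Let $p(n,k,t,r)$ be the number of $k$-tuples $(\alpha^1,\alpha^2,\ldots,\alpha^k)$ of partitions with $|\alpha^1|+\cdots+|\alpha^k|=n$ such that each $\alpha^i$ is a strict partition, $\alpha^1,\ldots,\alpha^r$ each have length $t$, and $\alpha^{r+1},\ldots,\alpha^k$ each have length $t-1$. Let $q(n,k,t,r)$ be the number of Schmidt $k$-partitions of $n$ with exactly $(t-1)k+r$ parts. Then $p(n,k,t,r)=q(n,k,t,r)$.
   Context: A partition is a finite weakly decreasing sequence of positive integers $\lambda=(\lambda_1,\ldots,\lambda_l)$; its parts are the $\lambda_i$, its length $\ell(\lambda)=l$ is the number of parts, and its weight is $|\lambda|=\sum_i\lambda_i$. A strict partition is one whose parts are pairwise distinct (strictly decreasing). A Schmidt $k$-partition of $n$ is a partition $(\lambda_1,\lambda_2,\lambda_3,\ldots)$ with $\lambda_1>\lambda_2>\lambda_3>\cdots$ and $\lambda_1+\lambda_{k+1}+\lambda_{2k+1}+\cdots=n$. -}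

module Defs where

open import Data.Nat using (ℕ; zero; suc; _+_; _*_; _∸_; _<_; _>_; _≤_)
open import Data.List using (List; []; _∷_; length; map)
open import Data.Nat.ListAction using (sum)
open import Data.List.Relation.Unary.All using (All)
open import Data.List.Relation.Unary.Linked using (Linked)
open import Data.Product using (Σ; _×_)
open import Data.Unit using (⊤)
open import Data.Fin using (Fin)
open import Function.Bundles using (_↔_)
open import Relation.Binary.PropositionalEquality using (_≡_)

weight : List ℕ → ℕ
weight = sum

StrictPartition : List ℕ → Set
StrictPartition λs = All (0 <_) λs × Linked _>_ λs

LengthPattern : ℕ → ℕ → List (List ℕ) → Set
LengthPattern t r       []       = ⊤
LengthPattern t zero    (a ∷ as) = (length a ≡ t ∸ 1) × LengthPattern t zero as
LengthPattern t (suc r) (a ∷ as) = (length a ≡ t) × LengthPattern t r as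

PTuples : ℕ → ℕ → ℕ → ℕ → Set
PTuples n k t r =
  Σ (List (List ℕ)) λ αs →
      (length αs ≡ k)
    × All StrictPartition αs
    × (sum (map weight αs) ≡ n)
    × LengthPattern t r αs

-- With c = 0 this sums the parts at 0-based positions 0, k, 2k, …
schmidtGo : ℕ → ℕ → List ℕ → ℕ
schmidtGo k c       []       = 0
schmidtGo k zero    (x ∷ xs) = x + schmidtGo k (k ∸ 1) xs
schmidtGo k (suc c) (x ∷ xs) = schmidtGo k c xs

schmidtSum : ℕ → List ℕ → ℕ
schmidtSum k λs = schmidtGo k 0 λs

SchmidtPartitions : ℕ → ℕ → ℕ → Set
SchmidtPartitions n k m =
  Σ (List ℕ) λ λs →
      StrictPartition λs
    × (schmidtSum k λs ≡ n)
    × (length λs ≡ m)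

QPartitions : ℕ → ℕ → ℕ → ℕ → Set
QPartitions n k t r = SchmidtPartitions n k ((t ∸ 1) * k + r)

HasCard : Set → ℕ → Set
HasCard A m = A ↔ Fin m

{-# OPTIONS --safe #-}

-- A strict partition λ with m parts is determined by its gaps dᵢ = λᵢ − λᵢ₊₁ (with
-- dₘ = λₘ), which form an arbitrary list of positive integers, via λᵢ = dᵢ + ⋯ + dₘ.
-- In these terms λ₁ + λ_{k+1} + λ_{2k+1} + ⋯ = Σᵢ ⌈i/k⌉ dᵢ, while |λ| = Σᵢ i dᵢ.
-- Writing the gaps of a Schmidt k-partition with (t−1)k + r parts row by row into k
-- columns yields r columns of length t followed by k − r of length t − 1; read as gap
-- lists, the columns are the strict partitions αʲ, and the entry dᵢ, lying in row ⌈i/k⌉,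
-- contributes ⌈i/k⌉ dᵢ to the total weight on both sides.
module Submission where

open import Defs
open import Data.Nat using (ℕ; zero; suc; _+_; _*_; _∸_; _<_; _≤_; z≤n; s≤s)
open import Data.Nat.Properties
  using (+-identityʳ; +-assoc; +-commutativeSemigroup; m∸n+n≡m; m+n∸n≡m; m+n∸m≡n;
         m<n⇒0<n∸m; m<n+m; m≤m+n; m≤n⇒m⊓n≡m; <⇒≤; ≤-trans; suc-injective; <-irrelevant;
         ≡-irrelevant)
open import Algebra.Properties.CommutativeSemigroup +-commutativeSemigroup using (interchange)
open import Data.List using (List; []; _∷_; [_]; _++_; length; map; concat; take; drop; zipWith)
open import Data.List.Properties
  using (length-map; length-++; length-take; length-drop; take++drop≡id; drop-all; map-∘)
open import Data.Nat.ListAction using (sum)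
open import Data.Nat.ListAction.Properties using (sum-++)
open import Data.List.Relation.Unary.All as All using (All; []; _∷_)
open import Data.List.Relation.Unary.All.Properties using (map⁺; concat⁺; ++⁺; take⁺; drop⁺)
open import Data.List.Relation.Unary.Linked as Linked using (Linked; []; [-]; _∷_)
open import Data.Product using (Σ; ∃₂; _×_; _,_)
open import Data.Product.Properties using (Σ-≡,≡→≡)
open import Data.Unit using (tt)
open import Data.Fin.Permutation using (↔⇒≡)
open import Function using (_∘_)
open import Function.Bundles using (_↔_; mk↔ₛ′)
open import Function.Construct.Composition using (_↔-∘_)
open import Function.Construct.Symmetry using (↔-sym)
open import Relation.Nullary.Irrelevant using (Irrelevant)
open import Relation.Binary.PropositionalEquality
  using (_≡_; refl; sym; trans; cong; cong₂; subst; module ≡-Reasoning)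

private
  variable
    A : Set

-- Gaps of a strict partition

Composition : List ℕ → Set
Composition = All (0 <_)

suffixSums : List ℕ → List ℕ
suffixSums []       = []
suffixSums (d ∷ ds) = (d + sum ds) ∷ suffixSums ds

differences : List ℕ → List ℕ
differences []           = []
differences (x ∷ [])     = x ∷ []
differences (x ∷ y ∷ xs) = (x ∸ y) ∷ differences (y ∷ xs)

length-suffixSums : ∀ ds → length (suffixSums ds) ≡ length ds
length-suffixSums []       = refl
length-suffixSums (d ∷ ds) = cong suc (length-suffixSums ds)

length-differences : ∀ xs → length (differences xs) ≡ length xs
length-differences []           = refl
length-differences (x ∷ [])     = refl
length-differences (x ∷ y ∷ xs) = cong suc (length-differences (y ∷ xs))

StrictPartition-tail : ∀ {x xs} → StrictPartition (x ∷ xs) → StrictPartition xs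
StrictPartition-tail (_ ∷ pos , linked) = pos , Linked.tail linked

sum-differences : ∀ x xs → StrictPartition (x ∷ xs) → sum (differences (x ∷ xs)) ≡ x
sum-differences x []       _ = +-identityʳ x
sum-differences x (y ∷ xs) s@(_ , y<x ∷ _) = begin
  (x ∸ y) + sum (differences (y ∷ xs)) ≡⟨ cong ((x ∸ y) +_) (sum-differences y xs (StrictPartition-tail s)) ⟩
  (x ∸ y) + y                          ≡⟨ m∸n+n≡m (<⇒≤ y<x) ⟩
  x                                    ∎
  where open ≡-Reasoning

suffixSums-differences : ∀ xs → StrictPartition xs → suffixSums (differences xs) ≡ xs
suffixSums-differences []           _ = refl
suffixSums-differences (x ∷ [])     _ = cong [_] (+-identityʳ x)
suffixSums-differences (x ∷ y ∷ xs) s =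
  cong₂ _∷_ (sum-differences x (y ∷ xs) s) (suffixSums-differences (y ∷ xs) (StrictPartition-tail s))

differences-suffixSums : ∀ ds → differences (suffixSums ds) ≡ ds
differences-suffixSums []           = refl
differences-suffixSums (d ∷ [])     = cong [_] (+-identityʳ d)
differences-suffixSums (d ∷ e ∷ ds) = cong₂ _∷_ (m+n∸n≡m d (e + sum ds)) (differences-suffixSums (e ∷ ds))

Composition-differences : ∀ {xs} → StrictPartition xs → Composition (differences xs)
Composition-differences {[]}         _               = []
Composition-differences {x ∷ []}     (0<x ∷ _ , _)    = 0<x ∷ []
Composition-differences {x ∷ y ∷ xs} s@(_ , y<x ∷ _) =
  m<n⇒0<n∸m y<x ∷ Composition-differences (StrictPartition-tail s)

StrictPartition-suffixSums : ∀ {ds} → Composition ds → StrictPartition (suffixSums ds)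
StrictPartition-suffixSums {[]}         _          = [] , []
StrictPartition-suffixSums {d ∷ []}     (0<d ∷ _)  = ≤-trans 0<d (m≤m+n d 0) ∷ [] , [-]
StrictPartition-suffixSums {d ∷ e ∷ ds} (0<d ∷ ps) with StrictPartition-suffixSums ps
... | pos , linked = ≤-trans 0<d (m≤m+n d _) ∷ pos , m<n+m (e + sum ds) 0<d ∷ linked

map-differences-suffixSums : ∀ dss → map differences (map suffixSums dss) ≡ dss
map-differences-suffixSums []         = refl
map-differences-suffixSums (ds ∷ dss) = cong₂ _∷_ (differences-suffixSums ds) (map-differences-suffixSums dss)

map-suffixSums-differences : ∀ αs → All StrictPartition αs → map suffixSums (map differences αs) ≡ αs
map-suffixSums-differences []       []       = refl
map-suffixSums-differences (α ∷ αs) (s ∷ ss) =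
  cong₂ _∷_ (suffixSums-differences α s) (map-suffixSums-differences αs ss)

-- The Schmidt sum in terms of gaps

schmidtGo-drop : ∀ k c (xs : List ℕ) → schmidtGo k c xs ≡ schmidtSum k (drop c xs)
schmidtGo-drop k zero    xs       = refl
schmidtGo-drop k (suc c) []       = refl
schmidtGo-drop k (suc c) (x ∷ xs) = schmidtGo-drop k c xs

drop-suffixSums : ∀ c ds → drop c (suffixSums ds) ≡ suffixSums (drop c ds)
drop-suffixSums zero    ds       = refl
drop-suffixSums (suc c) []       = refl
drop-suffixSums (suc c) (d ∷ ds) = drop-suffixSums c ds

-- λ₁ is the sum of all gaps, and λ_{k+1}, λ_{2k+1}, … are the suffix sums of the gaps after the first k.
schmidtSum-suffixSums : ∀ k ds →
  schmidtSum (suc k) (suffixSums ds) ≡ sum ds + schmidtSum (suc k) (suffixSums (drop (suc k) ds))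
schmidtSum-suffixSums k []       = refl
schmidtSum-suffixSums k (d ∷ ds) =
  cong ((d + sum ds) +_) (trans (schmidtGo-drop (suc k) k (suffixSums ds))
                                (cong (schmidtSum (suc k)) (drop-suffixSums k ds)))

-- Grids of columns

sum-take+sum-drop : ∀ n ds → sum (take n ds) + sum (drop n ds) ≡ sum ds
sum-take+sum-drop n ds = trans (sym (sum-++ (take n ds) (drop n ds))) (cong sum (take++drop≡id n ds))

sum-map-+ : ∀ (f g : A → ℕ) xs → sum (map (λ x → f x + g x) xs) ≡ sum (map f xs) + sum (map g xs)
sum-map-+ f g []       = refl
sum-map-+ f g (x ∷ xs) = trans (cong ((f x + g x) +_) (sum-map-+ f g xs)) (interchange (f x) (g x) _ _)

take-++ : ∀ n (xs ys : List A) → length xs ≡ n → take n (xs ++ ys) ≡ xs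
take-++ zero    []       ys _  = refl
take-++ (suc n) (x ∷ xs) ys eq = cong (x ∷_) (take-++ n xs ys (suc-injective eq))

drop-++ : ∀ n (xs ys : List A) → length xs ≡ n → drop n (xs ++ ys) ≡ ys
drop-++ zero    []       ys _  = refl
drop-++ (suc n) (x ∷ xs) ys eq = drop-++ n xs ys (suc-injective eq)

prependRow : List A → List (List A) → List (List A)
prependRow = zipWith _∷_

length-prependRow : ∀ (xs : List A) (cs : List (List A)) → length xs ≡ length cs →
                    length (prependRow xs cs) ≡ length cs
length-prependRow []       []       _  = refl
length-prependRow (x ∷ xs) (c ∷ cs) eq = cong suc (length-prependRow xs cs (suc-injective eq))

All-prependRow : ∀ {P : A → Set} {xs cs} → All P xs → All (All P) cs → All (All P) (prependRow xs cs)
All-prependRow []       _        = []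
All-prependRow (_ ∷ _)  []       = []
All-prependRow (p ∷ ps) (q ∷ qs) = (p ∷ q) ∷ All-prependRow ps qs

sum-map-prependRow : ∀ (f g : List ℕ → ℕ) → (∀ x c → f (x ∷ c) ≡ x + g c) →
                     ∀ xs cs → length xs ≡ length cs →
                     sum (map f (prependRow xs cs)) ≡ sum xs + sum (map g cs)
sum-map-prependRow f g f-∷ []       []       _  = refl
sum-map-prependRow f g f-∷ (x ∷ xs) (c ∷ cs) eq = begin
  f (x ∷ c) + sum (map f (prependRow xs cs))
    ≡⟨ cong₂ _+_ (f-∷ x c) (sum-map-prependRow f g f-∷ xs cs (suc-injective eq)) ⟩
  (x + g c) + (sum xs + sum (map g cs))
    ≡⟨ interchange x (g c) (sum xs) (sum (map g cs)) ⟩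
  (x + sum xs) + (g c + sum (map g cs))
    ∎
  where open ≡-Reasoning

-- The bottom row of the grid: xs placed at the heads of the first length xs of k columns
-- (entries beyond the k-th are dropped).
spread : ℕ → List A → List (List A)
spread zero    _        = []
spread (suc k) []       = [] ∷ spread k []
spread (suc k) (x ∷ xs) = [ x ] ∷ spread k xs

-- ds written row by row into k columns: for length ds ≡ t * k + r with r ≤ k, these are
-- t full rows above a bottom row of r entries.
columns : ℕ → ℕ → List A → List (List A)
columns k zero    ds = spread k ds
columns k (suc t) ds = prependRow (take k ds) (columns k t (drop k ds))

rowMajor : ℕ → List (List A) → List A
rowMajor zero    cs = concat cs
rowMajor (suc t) cs = concat (map (take 1) cs) ++ rowMajor t (map (drop 1) cs)

length-spread : ∀ k (xs : List A) → length (spread k xs) ≡ k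
length-spread zero    _        = refl
length-spread (suc k) []       = cong suc (length-spread k [])
length-spread (suc k) (x ∷ xs) = cong suc (length-spread k xs)

concat-spread : ∀ k (xs : List A) → length xs ≤ k → concat (spread k xs) ≡ xs
concat-spread zero    []       _         = refl
concat-spread (suc k) []       _         = concat-spread k [] z≤n
concat-spread (suc k) (x ∷ xs) (s≤s len) = cong (x ∷_) (concat-spread k xs len)

All-spread : ∀ {P : A → Set} k {xs} → All P xs → All (All P) (spread k xs)
All-spread zero    _        = []
All-spread (suc k) []       = [] ∷ All-spread k []
All-spread (suc k) (p ∷ ps) = (p ∷ []) ∷ All-spread k ps

sum-map-spread : ∀ (f : List ℕ → ℕ) → f [] ≡ 0 → (∀ x → f [ x ] ≡ x) →
                 ∀ k xs → length xs ≤ k → sum (map f (spread k xs)) ≡ sum xs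
sum-map-spread f f-[] f-[x] zero    []       _         = refl
sum-map-spread f f-[] f-[x] (suc k) []       _         =
  cong₂ _+_ f-[] (sum-map-spread f f-[] f-[x] k [] z≤n)
sum-map-spread f f-[] f-[x] (suc k) (x ∷ xs) (s≤s len) =
  cong₂ _+_ (f-[x] x) (sum-map-spread f f-[] f-[x] k xs len)

LengthPattern-spread : ∀ k r xs → r ≤ k → length xs ≡ r → LengthPattern 1 r (spread k xs)
LengthPattern-spread zero    zero    []       _         _  = tt
LengthPattern-spread (suc k) zero    []       _         _  = refl , LengthPattern-spread k zero [] z≤n refl
LengthPattern-spread (suc k) (suc r) (x ∷ xs) (s≤s r≤k) eq =
  refl , LengthPattern-spread k r xs r≤k (suc-injective eq)

spread-surjective : ∀ k r cs → r ≤ k → length cs ≡ k → LengthPattern 1 r cs →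
                    Σ (List ℕ) λ xs → length xs ≡ r × spread k xs ≡ cs
spread-surjective zero    zero    []               _         _   _       = [] , refl , refl
spread-surjective (suc k) zero    ([] ∷ cs)        _         len (_ , p)
  with spread-surjective k zero cs z≤n (suc-injective len) p
... | [] , refl , refl = [] , refl , refl
spread-surjective (suc k) (suc r) ((x ∷ []) ∷ cs)  (s≤s r≤k) len (_ , p)
  with spread-surjective k r cs r≤k (suc-injective len) p
... | xs , refl , refl = x ∷ xs , refl , refl

LengthPattern-map : ∀ t r (f : List ℕ → List ℕ) → (∀ c → length (f c) ≡ length c) →
                    ∀ cs → LengthPattern t r cs → LengthPattern t r (map f cs)
LengthPattern-map t r       f f-len []       _       = tt
LengthPattern-map t zero    f f-len (c ∷ cs) (ℓ , p) = trans (f-len c) ℓ , LengthPattern-map t zero f f-len cs p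
LengthPattern-map t (suc r) f f-len (c ∷ cs) (ℓ , p) = trans (f-len c) ℓ , LengthPattern-map t r f f-len cs p

LengthPattern-prependRow : ∀ t r xs cs → length xs ≡ length cs → LengthPattern (suc t) r cs →
                           LengthPattern (suc (suc t)) r (prependRow xs cs)
LengthPattern-prependRow t r       []       []       _  _       = tt
LengthPattern-prependRow t zero    (x ∷ xs) (c ∷ cs) eq (ℓ , p) =
  cong suc ℓ , LengthPattern-prependRow t zero xs cs (suc-injective eq) p
LengthPattern-prependRow t (suc r) (x ∷ xs) (c ∷ cs) eq (ℓ , p) =
  cong suc ℓ , LengthPattern-prependRow t r xs cs (suc-injective eq) p

prependRow-surjective : ∀ t r cs → LengthPattern (suc (suc t)) r cs →
                        ∃₂ λ xs cs′ → length xs ≡ length cs′ × LengthPattern (suc t) r cs′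
                                      × prependRow xs cs′ ≡ cs
prependRow-surjective t r       []              _       = [] , [] , refl , tt , refl
prependRow-surjective t zero    ((x ∷ c) ∷ cs) (ℓ , p) with prependRow-surjective t zero cs p
... | xs , cs′ , eq , p′ , refl = x ∷ xs , c ∷ cs′ , cong suc eq , (suc-injective ℓ , p′) , refl
prependRow-surjective t (suc r) ((x ∷ c) ∷ cs) (ℓ , p) with prependRow-surjective t r cs p
... | xs , cs′ , eq , p′ , refl = x ∷ xs , c ∷ cs′ , cong suc eq , (suc-injective ℓ , p′) , refl

rowMajor-prependRow : ∀ t (xs : List A) (cs : List (List A)) → length xs ≡ length cs →
                      rowMajor (suc t) (prependRow xs cs) ≡ xs ++ rowMajor t cs
rowMajor-prependRow t xs cs eq = cong₂ (λ ys zs → ys ++ rowMajor t zs) (firstRow xs cs eq) (otherRows xs cs eq)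
  where
  firstRow : ∀ (xs : List A) (cs : List (List A)) → length xs ≡ length cs →
             concat (map (take 1) (prependRow xs cs)) ≡ xs
  firstRow []       []       _  = refl
  firstRow (x ∷ xs) (c ∷ cs) eq = cong (x ∷_) (firstRow xs cs (suc-injective eq))
  otherRows : ∀ (xs : List A) (cs : List (List A)) → length xs ≡ length cs →
              map (drop 1) (prependRow xs cs) ≡ cs
  otherRows []       []       _  = refl
  otherRows (x ∷ xs) (c ∷ cs) eq = cong (c ∷_) (otherRows xs cs (suc-injective eq))

All-columns : ∀ {P : A → Set} k t {ds} → All P ds → All (All P) (columns k t ds)
All-columns k zero    ps = All-spread k ps
All-columns k (suc t) ps = All-prependRow (take⁺ k ps) (All-columns k t (drop⁺ k ps))

All-rowMajor : ∀ {P : A → Set} t {cs} → All (All P) cs → All P (rowMajor t cs)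
All-rowMajor zero    ps = concat⁺ ps
All-rowMajor (suc t) ps =
  ++⁺ (concat⁺ (map⁺ (All.map (take⁺ 1) ps))) (All-rowMajor t (map⁺ (All.map (drop⁺ 1) ps)))

module _ {k r : ℕ} (r≤k : r ≤ k) where

  length-take-row : ∀ t (ds : List A) → length ds ≡ suc t * k + r → length (take k ds) ≡ k
  length-take-row t ds eq =
    trans (length-take k ds) (m≤n⇒m⊓n≡m (subst (k ≤_) (sym eq) (≤-trans (m≤m+n k (t * k)) (m≤m+n _ r))))

  length-drop-row : ∀ t (ds : List A) → length ds ≡ suc t * k + r → length (drop k ds) ≡ t * k + r
  length-drop-row t ds eq = begin
    length (drop k ds)  ≡⟨ length-drop k ds ⟩
    length ds ∸ k       ≡⟨ cong (_∸ k) (trans eq (+-assoc k (t * k) r)) ⟩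
    k + (t * k + r) ∸ k ≡⟨ m+n∸m≡n k (t * k + r) ⟩
    t * k + r           ∎
    where open ≡-Reasoning

  length-columns : ∀ t (ds : List A) → length ds ≡ t * k + r → length (columns k t ds) ≡ k
  length-columns zero    ds _  = length-spread k ds
  length-columns (suc t) ds eq =
    trans (length-prependRow (take k ds) _ (trans (length-take-row t ds eq) (sym ih))) ih
    where ih = length-columns t (drop k ds) (length-drop-row t ds eq)

  row-fits : ∀ t (ds : List A) → length ds ≡ suc t * k + r →
             length (take k ds) ≡ length (columns k t (drop k ds))
  row-fits t ds eq =
    trans (length-take-row t ds eq) (sym (length-columns t (drop k ds) (length-drop-row t ds eq)))

  LengthPattern-columns : ∀ t ds → length ds ≡ t * k + r → LengthPattern (suc t) r (columns k t ds)
  LengthPattern-columns zero    ds eq = LengthPattern-spread k r ds r≤k eq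
  LengthPattern-columns (suc t) ds eq =
    LengthPattern-prependRow t r (take k ds) _ (row-fits t ds eq)
      (LengthPattern-columns t (drop k ds) (length-drop-row t ds eq))

  rowMajor-columns : ∀ t (ds : List A) → length ds ≡ t * k + r → rowMajor t (columns k t ds) ≡ ds
  rowMajor-columns zero    ds eq = concat-spread k ds (subst (_≤ k) (sym eq) r≤k)
  rowMajor-columns (suc t) ds eq = begin
    rowMajor (suc t) (prependRow (take k ds) (columns k t (drop k ds)))
      ≡⟨ rowMajor-prependRow t (take k ds) _ (row-fits t ds eq) ⟩
    take k ds ++ rowMajor t (columns k t (drop k ds))
      ≡⟨ cong (take k ds ++_) (rowMajor-columns t (drop k ds) (length-drop-row t ds eq)) ⟩
    take k ds ++ drop k ds
      ≡⟨ take++drop≡id k ds ⟩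
    ds
      ∎
    where open ≡-Reasoning

  columns-surjective : ∀ t cs → length cs ≡ k → LengthPattern (suc t) r cs →
                       Σ (List ℕ) λ ds → length ds ≡ t * k + r × columns k t ds ≡ cs
  columns-surjective zero    cs len p = spread-surjective k r cs r≤k len p
  columns-surjective (suc t) cs len p with prependRow-surjective t r cs p
  ... | xs , cs′ , fits , p′ , refl with columns-surjective t cs′ len′ p′
    where len′ = trans (sym (length-prependRow xs cs′ fits)) len
  ... | ds , ℓ , refl = xs ++ ds , length-xs++ds , cong₂ prependRow (take-++ k xs ds len-xs) drop-row
    where
    len-xs : length xs ≡ k
    len-xs = trans fits (trans (sym (length-prependRow xs _ fits)) len)
    length-xs++ds : length (xs ++ ds) ≡ suc t * k + r
    length-xs++ds = trans (length-++ xs) (trans (cong₂ _+_ len-xs ℓ) (sym (+-assoc k (t * k) r)))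
    drop-row : columns k t (drop k (xs ++ ds)) ≡ columns k t ds
    drop-row = cong (columns k t) (drop-++ k xs ds len-xs)

  columns-rowMajor : ∀ t cs → length cs ≡ k → LengthPattern (suc t) r cs → columns k t (rowMajor t cs) ≡ cs
  columns-rowMajor t cs len p with columns-surjective t cs len p
  ... | ds , ℓ , refl = cong (columns k t) (rowMajor-columns t ds ℓ)

  length-rowMajor : ∀ t cs → length cs ≡ k → LengthPattern (suc t) r cs → length (rowMajor t cs) ≡ t * k + r
  length-rowMajor t cs len p with columns-surjective t cs len p
  ... | ds , ℓ , refl = trans (cong length (rowMajor-columns t ds ℓ)) ℓ

  sum-columns : ∀ t ds → length ds ≡ t * k + r → sum (map sum (columns k t ds)) ≡ sum ds
  sum-columns zero    ds eq = sum-map-spread sum refl +-identityʳ k ds (subst (_≤ k) (sym eq) r≤k)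
  sum-columns (suc t) ds eq = begin
    sum (map sum (prependRow (take k ds) (columns k t (drop k ds))))
      ≡⟨ sum-map-prependRow sum sum (λ _ _ → refl) (take k ds) _ (row-fits t ds eq) ⟩
    sum (take k ds) + sum (map sum (columns k t (drop k ds)))
      ≡⟨ cong (sum (take k ds) +_) (sum-columns t (drop k ds) (length-drop-row t ds eq)) ⟩
    sum (take k ds) + sum (drop k ds)
      ≡⟨ sum-take+sum-drop k ds ⟩
    sum ds
      ∎
    where open ≡-Reasoning

module _ {k r : ℕ} (r≤k : r ≤ suc k) where

  -- Putting a full row on top of the grid adds sum ds to both sides: each column gains a
  -- new largest part, the sum of the column, and the Schmidt sum gains the new λ₁.
  weight-columns : ∀ t ds → length ds ≡ t * suc k + r →
                   sum (map (weight ∘ suffixSums) (columns (suc k) t ds))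
                     ≡ schmidtSum (suc k) (suffixSums ds)
  weight-columns zero ds eq = begin
    sum (map (weight ∘ suffixSums) (spread (suc k) ds))
      ≡⟨ sum-map-spread (weight ∘ suffixSums) refl (λ x → trans (+-identityʳ _) (+-identityʳ x))
                        (suc k) ds short ⟩
    sum ds
      ≡⟨ +-identityʳ (sum ds) ⟨
    sum ds + schmidtSum (suc k) (suffixSums [])
      ≡⟨ cong (λ ys → sum ds + schmidtSum (suc k) (suffixSums ys)) (drop-all (suc k) ds short) ⟨
    sum ds + schmidtSum (suc k) (suffixSums (drop (suc k) ds))
      ≡⟨ schmidtSum-suffixSums k ds ⟨
    schmidtSum (suc k) (suffixSums ds)
      ∎
    where
    open ≡-Reasoning
    short : length ds ≤ suc k
    short = subst (_≤ suc k) (sym eq) r≤k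
  weight-columns (suc t) ds eq = begin
    sum (map f (prependRow xs cs))
      ≡⟨ sum-map-prependRow f (λ c → sum c + f c) (λ x c → +-assoc x (sum c) (f c))
                            xs cs (row-fits r≤k t ds eq) ⟩
    sum xs + sum (map (λ c → sum c + f c) cs)
      ≡⟨ cong (sum xs +_) (sum-map-+ sum f cs) ⟩
    sum xs + (sum (map sum cs) + sum (map f cs))
      ≡⟨ cong (sum xs +_) (cong₂ _+_ (sum-columns r≤k t rest rest-length)
                                     (weight-columns t rest rest-length)) ⟩
    sum xs + (sum rest + schmidtSum (suc k) (suffixSums rest))
      ≡⟨ +-assoc (sum xs) (sum rest) _ ⟨
    (sum xs + sum rest) + schmidtSum (suc k) (suffixSums rest)
      ≡⟨ cong (_+ schmidtSum (suc k) (suffixSums rest)) (sum-take+sum-drop (suc k) ds) ⟩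
    sum ds + schmidtSum (suc k) (suffixSums rest)
      ≡⟨ schmidtSum-suffixSums k ds ⟨
    schmidtSum (suc k) (suffixSums ds)
      ∎
    where
    open ≡-Reasoning
    f : List ℕ → ℕ
    f = weight ∘ suffixSums
    xs = take (suc k) ds
    rest = drop (suc k) ds
    rest-length : length rest ≡ t * suc k + r
    rest-length = length-drop-row r≤k t ds eq
    cs = columns (suc k) t rest

-- The bijection

×-irrelevant : {B : Set} → Irrelevant A → Irrelevant B → Irrelevant (A × B)
×-irrelevant irrA irrB (a , b) (a′ , b′) = cong₂ _,_ (irrA a a′) (irrB b b′)

StrictPartition-irrelevant : ∀ {xs} → Irrelevant (StrictPartition xs)
StrictPartition-irrelevant = ×-irrelevant (All.irrelevant <-irrelevant) (Linked.irrelevant <-irrelevant)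

LengthPattern-irrelevant : ∀ t r cs → Irrelevant (LengthPattern t r cs)
LengthPattern-irrelevant t r       []       tt tt = refl
LengthPattern-irrelevant t zero    (c ∷ cs) = ×-irrelevant ≡-irrelevant (LengthPattern-irrelevant t zero cs)
LengthPattern-irrelevant t (suc r) (c ∷ cs) = ×-irrelevant ≡-irrelevant (LengthPattern-irrelevant t r cs)

Σ-↔ : {B : Set} {P : A → Set} {Q : B → Set} →
      (∀ {a} → Irrelevant (P a)) → (∀ {b} → Irrelevant (Q b)) →
      (f : A → B) (g : B → A) → (∀ {a} → P a → Q (f a)) → (∀ {b} → Q b → P (g b)) →
      (∀ {a} → P a → g (f a) ≡ a) → (∀ {b} → Q b → f (g b) ≡ b) →
      Σ A P ↔ Σ B Q
Σ-↔ P-irr Q-irr f g f-Q g-P g∘f f∘g = mk↔ₛ′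
  (λ (a , p) → f a , f-Q p)
  (λ (b , q) → g b , g-P q)
  (λ (b , q) → Σ-≡,≡→≡ (f∘g q , Q-irr _ _))
  (λ (a , p) → Σ-≡,≡→≡ (g∘f p , P-irr _ _))

toColumns : ℕ → ℕ → List ℕ → List (List ℕ)
toColumns k t λs = map suffixSums (columns k t (differences λs))

fromColumns : ℕ → List (List ℕ) → List ℕ
fromColumns t αs = suffixSums (rowMajor t (map differences αs))

module _ {n k t r : ℕ} (r≤k : r ≤ suc k) where

  private
    K = suc k

    IsQPartition : List ℕ → Set
    IsQPartition λs = StrictPartition λs × schmidtSum K λs ≡ n × length λs ≡ t * K + r

    IsPTuple : List (List ℕ) → Set
    IsPTuple αs =
      length αs ≡ K × All StrictPartition αs × sum (map weight αs) ≡ n × LengthPattern (suc t) r αs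

  toColumns-PTuple : ∀ {λs} → IsQPartition λs → IsPTuple (toColumns K t λs)
  toColumns-PTuple {λs} (s , schmidt , len) =
      trans (length-map suffixSums cs) (length-columns r≤k t ds ds-length)
    , map⁺ (All.map StrictPartition-suffixSums (All-columns K t (Composition-differences s)))
    , weight-cs
    , LengthPattern-map (suc t) r suffixSums length-suffixSums cs (LengthPattern-columns r≤k t ds ds-length)
    where
    open ≡-Reasoning
    ds = differences λs
    ds-length = trans (length-differences λs) len
    cs = columns K t ds
    weight-cs : sum (map weight (map suffixSums cs)) ≡ n
    weight-cs = begin
      sum (map weight (map suffixSums cs)) ≡⟨ cong sum (map-∘ cs) ⟨
      sum (map (weight ∘ suffixSums) cs)   ≡⟨ weight-columns r≤k t ds ds-length ⟩
      schmidtSum K (suffixSums ds)         ≡⟨ cong (schmidtSum K) (suffixSums-differences λs s) ⟩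
      schmidtSum K λs                      ≡⟨ schmidt ⟩
      n                                    ∎

  fromColumns-QPartition : ∀ {αs} → IsPTuple αs → IsQPartition (fromColumns t αs)
  fromColumns-QPartition {αs} (len , ss , w , p) =
      StrictPartition-suffixSums (All-rowMajor t (map⁺ (All.map Composition-differences ss)))
    , schmidt
    , trans (length-suffixSums (rowMajor t dss)) (length-rowMajor r≤k t dss dss-length dss-pattern)
    where
    open ≡-Reasoning
    dss = map differences αs
    dss-length = trans (length-map differences αs) len
    dss-pattern = LengthPattern-map (suc t) r differences length-differences αs p
    schmidt : schmidtSum K (suffixSums (rowMajor t dss)) ≡ n
    schmidt = begin
      schmidtSum K (suffixSums (rowMajor t dss))
        ≡⟨ weight-columns r≤k t (rowMajor t dss) (length-rowMajor r≤k t dss dss-length dss-pattern) ⟨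
      sum (map (weight ∘ suffixSums) (columns K t (rowMajor t dss)))
        ≡⟨ cong (sum ∘ map (weight ∘ suffixSums)) (columns-rowMajor r≤k t dss dss-length dss-pattern) ⟩
      sum (map (weight ∘ suffixSums) dss)
        ≡⟨ cong sum (map-∘ dss) ⟩
      sum (map weight (map suffixSums dss))
        ≡⟨ cong (sum ∘ map weight) (map-suffixSums-differences αs ss) ⟩
      sum (map weight αs)
        ≡⟨ w ⟩
      n ∎

  fromColumns-toColumns : ∀ {λs} → IsQPartition λs → fromColumns t (toColumns K t λs) ≡ λs
  fromColumns-toColumns {λs} (s , _ , len) = begin
    suffixSums (rowMajor t (map differences (map suffixSums cs)))
      ≡⟨ cong (suffixSums ∘ rowMajor t) (map-differences-suffixSums cs) ⟩
    suffixSums (rowMajor t cs)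
      ≡⟨ cong suffixSums (rowMajor-columns r≤k t (differences λs) (trans (length-differences λs) len)) ⟩
    suffixSums (differences λs)
      ≡⟨ suffixSums-differences λs s ⟩
    λs ∎
    where
    open ≡-Reasoning
    cs = columns K t (differences λs)

  toColumns-fromColumns : ∀ {αs} → IsPTuple αs → toColumns K t (fromColumns t αs) ≡ αs
  toColumns-fromColumns {αs} (len , ss , _ , p) = begin
    map suffixSums (columns K t (differences (suffixSums (rowMajor t dss))))
      ≡⟨ cong (map suffixSums ∘ columns K t) (differences-suffixSums (rowMajor t dss)) ⟩
    map suffixSums (columns K t (rowMajor t dss))
      ≡⟨ cong (map suffixSums) (columns-rowMajor r≤k t dss (trans (length-map differences αs) len)
                                  (LengthPattern-map (suc t) r differences length-differences αs p)) ⟩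
    map suffixSums dss
      ≡⟨ map-suffixSums-differences αs ss ⟩
    αs ∎
    where
    open ≡-Reasoning
    dss = map differences αs

  QPartitions↔PTuples : QPartitions n K (suc t) r ↔ PTuples n K (suc t) r
  QPartitions↔PTuples =
    Σ-↔ (×-irrelevant StrictPartition-irrelevant (×-irrelevant ≡-irrelevant ≡-irrelevant))
        (×-irrelevant ≡-irrelevant (×-irrelevant (All.irrelevant StrictPartition-irrelevant)
          (×-irrelevant ≡-irrelevant (LengthPattern-irrelevant (suc t) r _))))
        (toColumns K t) (fromColumns t) toColumns-PTuple fromColumns-QPartition
        fromColumns-toColumns toColumns-fromColumns

theorem6 : (n k t r : ℕ) → 1 ≤ n → 1 ≤ k → 1 ≤ t → 1 ≤ r → r ≤ k →
           (p q : ℕ) → HasCard (PTuples n k t r) p → HasCard (QPartitions n k t r) q →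
           p ≡ q
theorem6 n (suc k) (suc t) r _ _ _ _ r≤k p q p-card q-card =
  ↔⇒≡ (q-card ↔-∘ (↔-sym (QPartitions↔PTuples r≤k) ↔-∘ ↔-sym p-card))
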